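{- RoCTL* is bisimulation invariant. That is, let $M=(S,R,g)$ and $\hat M=(\hat S,\hat R,\hat g)$ be RoCTL-structures, and let $w\in S$ and $\hat w\in\hat S$. Suppose there is a bisimulation from $(M,w)$ to $(\hat M,\hat w)$. Then for every RoCTL* formula $\phi$ we have $M,w\vDash\phi$ iff $\hat M,\hat w\vDash\phi$.
   Context: Fix a set $\mathcal V$ of atoms containing a distinguished atom $\mathbf v$. A structure $M=(S,R,g)$ has a nonempty set $S$, a serial relation $R$ on $S$, and a valuation $g:S\to2^{\mathcal V}$. A fullpath is an infinite $R$-chain $\sigma=\langle\sigma_0,\sigma_1,\dots\rangle$, with suffixes $\sigma_{\ge i}$ and prefixes $\sigma_{\le i}$. A fullpath is failure-free if $\mathbf v\notin g(\sigma_i)$ for all $i>0$. $ap(w)$ and $sp(w)$ are the sets of all, respectively all failure-free, fullpaths from $w$. $M$ is a RoCTL-structure if $sp(w)\neq\emptyset$ for all $w$. A deviation from $\sigma$ is a fullpath $\pi$ with $\pi_{\le i}=\sigma_{\le i}$ and $\pi_{\ge i+1}$ failure-free for some $i\ge0$. RoCTL* formulas: $\phi::=p\mid\neg\phi\mid\phi\wedge\phi\mid\phi U\phi\mid N\phi\mid A\phi\mid O\phi\mid\blacktriangle\phi$, with $p\in\mathcal V\setminus\{\mathbf v\}$. They are evaluated on fullpaths: - $N$ and $U$ are the usual next and until; - $A\phi$: $\phi$ holds on all fullpaths from $\sigma_0$; - $O\phi$: $\phi$ holds on all failure-free fullpaths from $\sigma_0$; - $\blacktriangle\phi$: $\phi$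 holds on $\sigma$ and on all deviations from $\sigma$. Truth at a world: $M,w\vDash\phi$ iff there is a fullpath $\pi$ with $\pi_0=w$ and $M,\pi\vDash\phi$. A bisimulation from $(M,w)$ to $(\hat M,\hat w)$ is a relation $\mathfrak B\subseteq S\times\hat S$ such that: - $(w,\hat w)\in\mathfrak B$; - $g(u)=\hat g(\hat u)$ for all $(u,\hat u)\in\mathfrak B$; - for all $(u,\hat u)\in\mathfrak B$ and $v$ with $uRv$, there is $\hat v$ with $\hat u\hat R\hat v$ and $(v,\hat v)\in\mathfrak B$; - for all $(u,\hat u)\in\mathfrak B$ and $\hat v$ with $\hat u\hat R\hat v$, there is $v$ with $uRv$ and $(v,\hat v)\in\mathfrak B$. -}

module Defs where

open import Data.Nat using (ℕ; zero; suc; _+_; _<_; _≤_)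
open import Data.Bool using (Bool; true; false)
open import Data.Product using (Σ; ∃; _×_; _,_)
open import Relation.Nullary using (¬_)
open import Relation.Binary.PropositionalEquality using (_≡_)
open import Function.Bundles using (_⇔_)

module RoCTL (V : Set) (v : V) where

  -- A structure M = (S, R, g) with R serial; valuations g : S → 2^V are
  -- represented as characteristic functions S → V → Bool.
  record Structure : Set₁ where
    field
      S      : Set
      R      : S → S → Set
      g      : S → V → Bool
      inhabited : S
      serial : ∀ x → ∃ λ y → R x y

  module _ (M : Structure) where
    open Structure M

    record Path : Set where
      constructor mkPath
      field
        at   : ℕ → S
        step : ∀ i → R (at i) (at (suc i))
    open Path public

    suffix : ℕ → Path → Path
    suffix i σ = mkPath (λ k → at σ (k + i)) (λ k → step σ (k + i))

    FailureFree : Path → Set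
    FailureFree σ = ∀ i → g (at σ (suc i)) v ≡ false

    IsRoCTLStructure : Set
    IsRoCTLStructure = ∀ w → Σ Path λ σ → (at σ 0 ≡ w) × FailureFree σ

    Deviation : Path → Path → Set
    Deviation σ π = ∃ λ i → (∀ k → k ≤ i → at π k ≡ at σ k) × FailureFree (suffix (suc i) π)

  data Form : Set where
    atom : (p : V) → ¬ (p ≡ v) → Form
    ¬'_  : Form → Form
    _∧'_ : Form → Form → Form
    _U_  : Form → Form → Form
    N    : Form → Form
    A    : Form → Form
    O    : Form → Form
    ▲    : Form → Form

  _,_⊨_ : (M : Structure) → Path M → Form → Set
  M , σ ⊨ atom p _ = Structure.g M (at σ 0) p ≡ true
  M , σ ⊨ (¬' φ)   = ¬ (M , σ ⊨ φ)
  M , σ ⊨ (φ ∧' ψ) = (M , σ ⊨ φ) × (M , σ ⊨ ψ)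
  M , σ ⊨ (φ U ψ)  = ∃ λ i → (M , suffix M i σ ⊨ ψ) × (∀ j → j < i → M , suffix M j σ ⊨ φ)
  M , σ ⊨ N φ      = M , suffix M 1 σ ⊨ φ
  M , σ ⊨ A φ      = ∀ (π : Path M) → at π 0 ≡ at σ 0 → M , π ⊨ φ
  M , σ ⊨ O φ      = ∀ (π : Path M) → at π 0 ≡ at σ 0 → FailureFree M π → M , π ⊨ φ
  M , σ ⊨ ▲ φ      = (M , σ ⊨ φ) × (∀ (π : Path M) → Deviation M σ π → M , π ⊨ φ)

  _,_⊨w_ : (M : Structure) → Structure.S M → Form → Set
  M , w ⊨w φ = Σ (Path M) λ π → (at π 0 ≡ w) × (M , π ⊨ φ)

  record Bisimulation (M M̂ : Structure) (w : Structure.S M) (ŵ : Structure.S M̂) : Set₁ where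
    open Structure M
    open Structure M̂ renaming (S to Ŝ; R to R̂; g to ĝ)
    field
      𝔅      : S → Ŝ → Set
      root   : 𝔅 w ŵ
      label  : ∀ u û → 𝔅 u û → ∀ p → g u p ≡ ĝ û p
      forth  : ∀ u û → 𝔅 u û → ∀ x → R u x → ∃ λ x̂ → R̂ û x̂ × 𝔅 x x̂
      back   : ∀ u û → 𝔅 u û → ∀ x̂ → R̂ û x̂ → ∃ λ x → R u x × 𝔅 x x̂

module Submission where

-- Call two fullpaths σ in M and σ̂ in M̂ *matched* by a bisimulation 𝔅 when
-- 𝔅 relates σ_k and σ̂_k for every k.  The heart of the proof is that
-- matched paths satisfy the same RoCTL* formulas (`transfer`), by induction
-- on the formula, simultaneously for 𝔅 and its converse (needed for ¬).
-- The path quantifiers need three facts about matched paths: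
--   * every path of M̂ can be pulled back along 𝔅 to a matched path of M
--     starting at any prescribed 𝔅-related world (`pullback`, for A and O);
--   * matched paths are failure-free together, since 𝔅 preserves the
--     valuation of the failure atom v (`failureFree-pullback`, for O and ▲);
--   * a deviation from σ̂ pulls back to a deviation from σ: keep σ up to the
--     branching index and graft on a pulled-back copy of the deviating tail
--     (`graft`, `pullback-deviation`, for ▲).
-- Truth at a world is the existence of a path, which transfers by lifting a
-- witness path from the root (`world-transfer`).

open import Defs
open import Function.Bundles using (_⇔_; mk⇔)
open import Data.Nat using (ℕ; zero; suc; _+_; _∸_; _≤_; z≤n; s≤s; _≤?_)
open import Data.Nat.Properties using (+-identityʳ; +-suc; m∸n+n≡m; ≤-refl; ≰⇒>; <⇒≤)
open import Data.Product using (Σ; ∃; _×_; _,_; proj₁; proj₂)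
open import Relation.Nullary using (yes; no)
open import Relation.Binary.PropositionalEquality using (_≡_; refl; sym; trans; cong; subst)

module Invariance (V : Set) (v : V) where
  open RoCTL V v
  open Bisimulation

  module _ {M : Structure} where
    open Structure M using (S; R)

    tail : Path M → Path M
    tail σ = mkPath (λ k → at σ (suc k)) (λ k → step σ (suc k))

    prepend : (s : S) (π : Path M) → R s (at π 0) → Path M
    prepend s π r = mkPath world edge
      where
        world : ℕ → S
        world zero    = s
        world (suc k) = at π k
        edge : ∀ k → R (world k) (world (suc k))
        edge zero    = r
        edge (suc k) = step π k

    mutual
      graft : (i : ℕ) (σ ρ : Path M) → at ρ 0 ≡ at σ i → Path M
      graft zero    σ ρ e = ρ
      graft (suc i) σ ρ e =
        prepend (at σ 0) (graft i (tail σ) ρ e)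
          (subst (R (at σ 0)) (sym (graft-start i (tail σ) ρ e)) (step σ 0))

      graft-start : (i : ℕ) (σ ρ : Path M) (e : at ρ 0 ≡ at σ i) → at (graft i σ ρ e) 0 ≡ at σ 0
      graft-start zero    σ ρ e = e
      graft-start (suc i) σ ρ e = refl

    graft-prefix : ∀ i (σ ρ : Path M) e k → k ≤ i → at (graft i σ ρ e) k ≡ at σ k
    graft-prefix zero    σ ρ e zero    z≤n      = e
    graft-prefix (suc i) σ ρ e zero    z≤n      = refl
    graft-prefix (suc i) σ ρ e (suc k) (s≤s le) = graft-prefix i (tail σ) ρ e k le

    graft-suffix : ∀ i (σ ρ : Path M) e j → at (graft i σ ρ e) (j + i) ≡ at ρ j
    graft-suffix zero    σ ρ e j = cong (at ρ) (+-identityʳ j)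
    graft-suffix (suc i) σ ρ e j rewrite +-suc j i = graft-suffix i (tail σ) ρ e j

  converse : ∀ {M M̂ w ŵ} → Bisimulation M M̂ w ŵ → Bisimulation M̂ M ŵ w
  converse B = record
    { 𝔅     = λ û u → 𝔅 B u û
    ; root  = root B
    ; label = λ û u b p → sym (label B u û b p)
    ; forth = λ û u b x̂ r → back B u û b x̂ r
    ; back  = λ û u b x r → forth B u û b x r
    }

  Matched : ∀ {M M̂ w ŵ} → Bisimulation M M̂ w ŵ → Path M → Path M̂ → Set
  Matched B σ σ̂ = ∀ k → 𝔅 B (at σ k) (at σ̂ k)

  -- Every path π̂ of M̂ has a matched path in M from any world related to π̂_0:
  -- choose its worlds one at a time using the back condition.
  pullback : ∀ {M M̂ w ŵ} (B : Bisimulation M M̂ w ŵ) (π̂ : Path M̂) (u : Structure.S M)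
           → 𝔅 B u (at π̂ 0) → Σ (Path M) λ π → (at π 0 ≡ u) × Matched B π π̂
  pullback {M} B π̂ u b = mkPath (λ k → proj₁ (worlds k)) edge , refl , λ k → proj₂ (worlds k)
    where
      open Structure M using (S; R)
      RelatedTo : ℕ → Set
      RelatedTo k = Σ S λ x → 𝔅 B x (at π̂ k)

      extend : ∀ k (x : RelatedTo k) → ∃ λ y → R (proj₁ x) y × 𝔅 B y (at π̂ (suc k))
      extend k x = back B (proj₁ x) (at π̂ k) (proj₂ x) (at π̂ (suc k)) (step π̂ k)

      worlds : ∀ k → RelatedTo k
      worlds zero    = u , b
      worlds (suc k) = proj₁ (extend k (worlds k)) , proj₂ (proj₂ (extend k (worlds k)))

      edge : ∀ k → R (proj₁ (worlds k)) (proj₁ (worlds (suc k)))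
      edge k = proj₁ (proj₂ (extend k (worlds k)))

  suffix-matched : ∀ {M M̂ w ŵ} (B : Bisimulation M M̂ w ŵ) σ σ̂ i
                 → Matched B σ σ̂ → Matched B (suffix M i σ) (suffix M̂ i σ̂)
  suffix-matched B σ σ̂ i m k = m (k + i)

  -- Related worlds agree on the failure atom v, so failure-freeness of σ̂
  -- carries over to every path matched with it.
  failureFree-pullback : ∀ {M M̂ w ŵ} (B : Bisimulation M M̂ w ŵ) σ σ̂
                       → Matched B σ σ̂ → FailureFree M̂ σ̂ → FailureFree M σ
  failureFree-pullback B σ σ̂ m ff i = trans (label B _ _ (m (suc i)) v) (ff i)

  graft-matched : ∀ {M M̂ w ŵ} (B : Bisimulation M M̂ w ŵ) i (σ ρ : Path M) e (π̂ : Path M̂)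
                → (∀ k → k ≤ i → 𝔅 B (at σ k) (at π̂ k)) → Matched B ρ (suffix M̂ i π̂)
                → Matched B (graft i σ ρ e) π̂
  graft-matched B i σ ρ e π̂ prefix rest k with k ≤? i
  ... | yes k≤i = subst (λ x → 𝔅 B x (at π̂ k)) (sym (graft-prefix i σ ρ e k k≤i)) (prefix k k≤i)
  ... | no  k≰i = subst (λ n → 𝔅 B (at (graft i σ ρ e) n) (at π̂ n)) (m∸n+n≡m (<⇒≤ (≰⇒> k≰i)))
                    (beyond (k ∸ i))
    where
      -- past index i the graft is ρ, which is matched with π̂_(≥ i)
      beyond : ∀ j → 𝔅 B (at (graft i σ ρ e) (j + i)) (at π̂ (j + i))
      beyond j = subst (λ x → 𝔅 B x (at π̂ (j + i))) (sym (graft-suffix i σ ρ e j)) (rest j)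

  -- A deviation from σ̂ pulls back to a deviation from σ matched with it:
  -- keep σ up to the branching index i and graft on a pullback of π̂_(≥ i).
  pullback-deviation : ∀ {M M̂ w ŵ} (B : Bisimulation M M̂ w ŵ) σ σ̂ (π̂ : Path M̂)
                     → Matched B σ σ̂ → Deviation M̂ σ̂ π̂
                     → Σ (Path M) λ π → Deviation M σ π × Matched B π π̂
  pullback-deviation {M} {M̂} B σ σ̂ π̂ m (i , agree , ff) =
    π , (i , graft-prefix i σ ρ ρ-start , ff-after-i) , π-matched
    where
      related-prefix : ∀ k → k ≤ i → 𝔅 B (at σ k) (at π̂ k)
      related-prefix k k≤i = subst (𝔅 B (at σ k)) (sym (agree k k≤i)) (m k)

      tail-pullback : Σ (Path M) λ ρ → (at ρ 0 ≡ at σ i) × Matched B ρ (suffix M̂ i π̂)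
      tail-pullback = pullback B (suffix M̂ i π̂) (at σ i) (related-prefix i ≤-refl)

      ρ : Path M
      ρ = proj₁ tail-pullback

      ρ-start : at ρ 0 ≡ at σ i
      ρ-start = proj₁ (proj₂ tail-pullback)

      π : Path M
      π = graft i σ ρ ρ-start

      π-matched : Matched B π π̂
      π-matched = graft-matched B i σ ρ ρ-start π̂ related-prefix (proj₂ (proj₂ tail-pullback))

      ff-after-i : FailureFree M (suffix M (suc i) π)
      ff-after-i = failureFree-pullback B (suffix M (suc i) π) (suffix M̂ (suc i) π̂)
                     (suffix-matched B π π̂ (suc i) π-matched) ff

  -- Matched paths satisfy the same formulas.  The converse bisimulation
  -- handles negation; pullbacks handle the path quantifiers A, O and ▲.
  transfer : ∀ {M M̂ w ŵ} (B : Bisimulation M M̂ w ŵ) (φ : Form) (σ : Path M) (σ̂ : Path M̂)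
           → Matched B σ σ̂ → M , σ ⊨ φ → M̂ , σ̂ ⊨ φ
  transfer B (atom p _) σ σ̂ m h = trans (sym (label B _ _ (m 0) p)) h
  transfer B (¬' φ)     σ σ̂ m h = λ ĥ → h (transfer (converse B) φ σ̂ σ m ĥ)
  transfer B (φ ∧' ψ)   σ σ̂ m (hφ , hψ) = transfer B φ σ σ̂ m hφ , transfer B ψ σ σ̂ m hψ
  transfer B (φ U ψ)    σ σ̂ m (i , hψ , hφ) =
    i , transfer B ψ _ _ (suffix-matched B σ σ̂ i m) hψ ,
    λ j j<i → transfer B φ _ _ (suffix-matched B σ σ̂ j m) (hφ j j<i)
  transfer B (N φ)      σ σ̂ m h = transfer B φ _ _ (suffix-matched B σ σ̂ 1 m) h
  transfer B (A φ)      σ σ̂ m h π̂ π̂-start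
    with pullback B π̂ (at σ 0) (subst (𝔅 B (at σ 0)) (sym π̂-start) (m 0))
  ... | π , π-start , π-matched = transfer B φ π π̂ π-matched (h π π-start)
  transfer B (O φ)      σ σ̂ m h π̂ π̂-start π̂-ff
    with pullback B π̂ (at σ 0) (subst (𝔅 B (at σ 0)) (sym π̂-start) (m 0))
  ... | π , π-start , π-matched =
    transfer B φ π π̂ π-matched (h π π-start (failureFree-pullback B π π̂ π-matched π̂-ff))
  transfer {M̂ = M̂} B (▲ φ) σ σ̂ m (h , h-deviations) = transfer B φ σ σ̂ m h , deviations
    where
      deviations : ∀ π̂ → Deviation M̂ σ̂ π̂ → M̂ , π̂ ⊨ φ
      deviations π̂ dev with pullback-deviation B σ σ̂ π̂ m dev
      ... | π , π-dev , π-matched = transfer B φ π π̂ π-matched (h-deviations π π-dev)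

  -- Truth at bisimilar roots transfers: a witness path from w pulls back
  -- (along the converse) to a matched witness path from ŵ.
  world-transfer : ∀ {M M̂ w ŵ} (B : Bisimulation M M̂ w ŵ) (φ : Form) → M , w ⊨w φ → M̂ , ŵ ⊨w φ
  world-transfer {ŵ = ŵ} B φ (π , π-start , h)
    with pullback (converse B) π ŵ (subst (λ x → 𝔅 B x ŵ) (sym π-start) (root B))
  ... | π̂ , π̂-start , matched = π̂ , π̂-start , transfer B φ π π̂ matched h

mainTheorem11 : (V : Set) (v : V) (M M̂ : RoCTL.Structure V v)
    → RoCTL.IsRoCTLStructure V v M → RoCTL.IsRoCTLStructure V v M̂
    → (w : RoCTL.Structure.S M) (ŵ : RoCTL.Structure.S M̂)
    → RoCTL.Bisimulation V v M M̂ w ŵ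
    → (φ : RoCTL.Form V v)
    → (RoCTL._,_⊨w_ V v M w φ) ⇔ (RoCTL._,_⊨w_ V v M̂ ŵ φ)
mainTheorem11 V v M M̂ _ _ w ŵ B φ =
  mk⇔ (world-transfer B φ) (world-transfer (converse B) φ)
  where open Invariance V v
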